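{- For every $n\ge 1$, the average, over all permutations $\pi$ of $\{1,\dots,n\}$, of the number of occurrences of the pattern 13-2 in $\mathrm{Flatten}(\pi)$ equals $\frac{n^2+3n+8}{12}-H_n$, where $H_n=\sum_{k=1}^n\frac1k$.
   Context: The standard cycle form of a permutation $\sigma$ of $\{1,\dots,n\}$ writes $\sigma$ as a product of disjoint cycles (fixed points included as 1-cycles), each cycle written starting with its smallest letter, the cycles arranged in increasing order of their smallest letters. $\mathrm{Flatten}(\sigma)$ is the word obtained by erasing the parentheses of the standard cycle form. An occurrence of the pattern 13-2 in a word $w_1\cdots w_n$ is a pair of indices $(i,j)$ with $2\le i<j\le n$ and $w_{i-1}<w_j<w_i$. -}

module Defs where

open import Data.Nat as ℕ using (ℕ; zero; suc; _!; _<ᵇ_; _≡ᵇ_)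
open import Data.Nat.Properties using (_!≢0)
open import Data.Bool using (Bool; true; false; if_then_else_; _∧_; not)
open import Data.List using (List; []; _∷_; _++_; concatMap; map; upTo; foldr)
open import Data.Bool.ListAction using (any)
open import Data.Integer using (+_)
open import Data.Rational as ℚ using (ℚ; _/_)

-- Permutations of {1,…,n} in one-line notation: the list σ(1) σ(2) … σ(n).
-- insertions x w : all ways to insert x into the word w.
insertions : ℕ → List ℕ → List (List ℕ)
insertions x []       = (x ∷ []) ∷ []
insertions x (y ∷ ys) = (x ∷ y ∷ ys) ∷ map (y ∷_) (insertions x ys)

perms : ℕ → List (List ℕ)
perms zero    = [] ∷ []
perms (suc n) = concatMap (insertions (suc n)) (perms n)

-- σ(i) for a permutation σ given in one-line notation (1-based; 0 if out of range).
apply : List ℕ → ℕ → ℕ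
apply []       _             = 0
apply (y ∷ ys) zero          = 0
apply (y ∷ ys) (suc zero)    = y
apply (y ∷ ys) (suc (suc i)) = apply ys (suc i)

-- The cycle of σ through `start`, listed start, σ(start), σ²(start), …
-- up to (excluding) the return to `start`; `fuel` bounds the length (n suffices).
cycleFrom : List ℕ → ℕ → ℕ → ℕ → List ℕ
cycleFrom σ zero       start cur = []
cycleFrom σ (suc fuel) start cur =
  cur ∷ (let nx = apply σ cur in
         if nx ≡ᵇ start then [] else cycleFrom σ fuel start nx)

elem : ℕ → List ℕ → Bool
elem x = any (x ≡ᵇ_)

-- Standard cycle form with parentheses erased: scan i = 1,…,n; whenever i has not
-- yet appeared, i is the smallest letter of its cycle, so write that cycle out.
flattenFrom : List ℕ → ℕ → List ℕ → List ℕ → List ℕ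
flattenFrom σ n []       acc = acc
flattenFrom σ n (i ∷ is) acc =
  if elem i acc then flattenFrom σ n is acc
                else flattenFrom σ n is (acc ++ cycleFrom σ n i i)

Flatten : ℕ → List ℕ → List ℕ
Flatten n σ = flattenFrom σ n (map suc (upTo n)) []

countBetween : ℕ → ℕ → List ℕ → ℕ
countBetween a b []       = 0
countBetween a b (c ∷ cs) =
  (if (a <ᵇ c) ∧ (c <ᵇ b) then 1 else 0) ℕ.+ countBetween a b cs

-- Number of occurrences of 13-2 in w₁⋯wₙ: pairs (i,j), 2 ≤ i < j ≤ n,
-- with w_{i-1} < w_j < w_i.  For each adjacent pair (w_{i-1}, w_i) we count
-- the later letters w_j strictly between them.
occ13-2 : List ℕ → ℕ
occ13-2 []            = 0
occ13-2 (a ∷ [])      = 0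
occ13-2 (a ∷ b ∷ rest) = countBetween a b rest ℕ.+ occ13-2 (b ∷ rest)

total13-2 : ℕ → ℕ
total13-2 n = foldr (λ σ s → occ13-2 (Flatten n σ) ℕ.+ s) 0 (perms n)

average13-2 : ℕ → ℚ
average13-2 n = (_/_ (+ total13-2 n) (n !)) {{n !≢0}}

harmonic : ℕ → ℚ
harmonic zero    = ℚ.0ℚ
harmonic (suc n) = harmonic n ℚ.+ (+ 1 / suc n)

module Submission where

-- Every permutation of {1,…,n+1} arises exactly once from a permutation σ of {1,…,n}, either by
-- adding the fixed point n+1 or by splicing n+1 into the cycle of σ right after a letter i
-- (`perms` inserts n+1 into the one-line notation instead; re-indexing S_n by a rotation turns
-- one construction into the other). The first appends n+1 to Flatten(σ), the second inserts it
-- right after the letter i. Inserting a new maximum right after a letter a destroys the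
-- occurrences of 13-2 that start at a and creates one for every later letter larger than a, so
-- summing over the n+1 children gives
--   T(n+1) = n·T(n) + U(n),   U(n+1) = (n+1)·U(n) + n!·(n(n+1)/2 + n),
-- where T and U count the occurrences of 13-2 and the non-inversions over all Flatten(σ).
-- These recurrences are solved by 12·T(n) = n!·(n²+3n+8) − 12·n!·H_n.

open import Defs
open import Data.Nat as ℕ using (ℕ; zero; suc; _+_; _*_; _≤_; _≥_; _<_; z≤n; s≤s; _≡ᵇ_; _<ᵇ_; _!)
open import Data.Nat.Properties as ℕP using (_!≢0)
open import Data.Nat.ListAction using (sum)
open import Data.Nat.ListAction.Properties using (sum-++; sum-↭)
open import Data.List using (List; []; _∷_; initLast; _∷ʳ′_; _++_; _∷ʳ_; [_]; map; concatMap; upTo; applyUpTo; length)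
open import Data.List.Properties as LP using ()
open import Data.List.Membership.Propositional using (_∈_; _∉_; find; lose)
open import Data.List.Membership.Propositional.Properties as ∈P using ()
open import Data.List.Relation.Unary.Any using (here; there)
open import Data.List.Relation.Binary.Permutation.Propositional as ↭ using (_↭_; ↭-refl; ↭-sym; ↭-trans; ↭-reflexive; prep; swap)
open import Data.List.Relation.Binary.Permutation.Propositional.Properties as ↭P using ()
open import Data.List.Relation.Unary.All as All using (All; []; _∷_)
open import Data.List.Relation.Unary.AllPairs using ([]; _∷_)
open import Data.List.Relation.Unary.Unique.Propositional using (Unique)
open import Data.List.Relation.Unary.Unique.Propositional.Properties as UniqueP using ()
import Data.List.Relation.Binary.Permutation.Setoid.Properties as ↭ₛP
open import Data.List.Relation.Binary.BagAndSetEquality using (∼bag⇒↭)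
open import Data.List.Membership.Propositional.Properties.WithK using (unique∧set⇒bag)
open import Data.Product using (∃; ∃₂; _×_; _,_; proj₁; proj₂)
open import Data.Sum as Sum using (_⊎_; inj₁; inj₂; [_,_]′)
open import Data.Bool using (true; false; T; _∨_; _∧_; if_then_else_)
import Data.Bool.Properties as BoolP
open import Data.Empty using (⊥-elim)
open import Function.Bundles using (mk⇔)
open import Function using (_∘_)
open import Relation.Nullary using (¬_; yes; no)
open import Relation.Binary.PropositionalEquality hiding ([_])
open import Data.Nat.Tactic.RingSolver using (solve-∀)

private variable A B : Set

∑ : List A → (A → ℕ) → ℕ
∑ xs f = sum (map f xs)

∑-cong : ∀ (xs : List A) {f g : A → ℕ} → (∀ x → x ∈ xs → f x ≡ g x) → ∑ xs f ≡ ∑ xs g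
∑-cong []       eq = refl
∑-cong (x ∷ xs) eq = cong₂ _+_ (eq x (here refl)) (∑-cong xs (λ y y∈ → eq y (there y∈)))

∑-++ : ∀ (xs ys : List A) f → ∑ (xs ++ ys) f ≡ ∑ xs f + ∑ ys f
∑-++ xs ys f = trans (cong sum (LP.map-++ f xs ys)) (sum-++ (map f xs) (map f ys))

∑-map : ∀ (h : A → B) xs f → ∑ (map h xs) f ≡ ∑ xs (λ x → f (h x))
∑-map h xs f = cong sum (sym (LP.map-∘ xs))

∑-concatMap : ∀ (g : A → List B) xs f → ∑ (concatMap g xs) f ≡ ∑ xs (λ x → ∑ (g x) f)
∑-concatMap g []       f = refl
∑-concatMap g (x ∷ xs) f = trans (∑-++ (g x) (concatMap g xs) f) (cong (∑ (g x) f +_) (∑-concatMap g xs f))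

∑-↭ : ∀ {xs ys : List A} f → xs ↭ ys → ∑ xs f ≡ ∑ ys f
∑-↭ f p = sum-↭ (↭P.map⁺ f p)

∑-+ : ∀ (xs : List A) f g → ∑ xs (λ x → f x + g x) ≡ ∑ xs f + ∑ xs g
∑-+ []       f g = refl
∑-+ (x ∷ xs) f g = trans (cong (f x + g x +_) (∑-+ xs f g)) (+-interchange (f x) (g x) _ _)
  where
  +-interchange : ∀ a b c d → a + b + (c + d) ≡ a + c + (b + d)
  +-interchange = solve-∀

∑-*ˡ : ∀ (xs : List A) c f → ∑ xs (λ x → c * f x) ≡ c * ∑ xs f
∑-*ˡ []       c f = sym (ℕP.*-zeroʳ c)
∑-*ˡ (x ∷ xs) c f = trans (cong (c * f x +_) (∑-*ˡ xs c f)) (sym (ℕP.*-distribˡ-+ c (f x) _))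

∑-const : ∀ (xs : List A) c → ∑ xs (λ _ → c) ≡ length xs * c
∑-const []       c = refl
∑-const (x ∷ xs) c = cong (c +_) (∑-const xs c)

∑-comm : ∀ (xs : List A) (ys : List B) (f : A → B → ℕ) →
         ∑ xs (λ x → ∑ ys (f x)) ≡ ∑ ys (λ y → ∑ xs (λ x → f x y))
∑-comm []       ys f = sym (trans (∑-const ys 0) (ℕP.*-zeroʳ (length ys)))
∑-comm (x ∷ xs) ys f =
  trans (cong (∑ ys (f x) +_) (∑-comm xs ys f)) (sym (∑-+ ys (f x) (λ y → ∑ xs (λ x′ → f x′ y))))

Unique-resp-↭ : ∀ {xs ys : List A} → xs ↭ ys → Unique xs → Unique ys
Unique-resp-↭ p = ↭ₛP.Unique-resp-↭ (setoid _) (↭.↭⇒↭ₛ p)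

oneTo : ℕ → List ℕ
oneTo n = map suc (upTo n)

oneTo-suc : ∀ n → oneTo (suc n) ≡ oneTo n ∷ʳ suc n
oneTo-suc n = trans (cong (map suc) (sym (LP.upTo-∷ʳ n))) (LP.map-++ suc (upTo n) [ n ])

length-oneTo : ∀ n → length (oneTo n) ≡ n
length-oneTo n = trans (LP.length-map suc (upTo n)) (LP.length-upTo n)

∈-oneTo⁺ : ∀ {n k} → k < n → suc k ∈ oneTo n
∈-oneTo⁺ k<n = ∈P.∈-map⁺ suc (∈P.∈-upTo⁺ k<n)

∈-oneTo⁻ : ∀ {n x} → x ∈ oneTo n → 1 ≤ x × x ≤ n
∈-oneTo⁻ p with j , j∈ , refl ← ∈P.∈-map⁻ suc p = s≤s z≤n , ∈P.∈-upTo⁻ j∈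

suc∉oneTo : ∀ n → suc n ∉ oneTo n
suc∉oneTo n p = ℕP.<-irrefl refl (proj₂ (∈-oneTo⁻ p))

oneTo-unique : ∀ n → Unique (oneTo n)
oneTo-unique n = UniqueP.map⁺ ℕP.suc-injective (UniqueP.upTo⁺ n)

insertAt : A → ℕ → List A → List A
insertAt x zero    v        = x ∷ v
insertAt x (suc k) []       = x ∷ []
insertAt x (suc k) (y ∷ ys) = y ∷ insertAt x k ys

insertAt-↭ : ∀ (x : A) k v → insertAt x k v ↭ x ∷ v
insertAt-↭ x zero    v        = ↭-refl
insertAt-↭ x (suc k) []       = ↭-refl
insertAt-↭ x (suc k) (y ∷ ys) = ↭-trans (prep y (insertAt-↭ x k ys)) (swap y x ↭-refl)

insertAt-length : ∀ (x : A) v → insertAt x (length v) v ≡ v ∷ʳ x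
insertAt-length x []       = refl
insertAt-length x (y ∷ ys) = cong (y ∷_) (insertAt-length x ys)

++-∷≡insertAt : ∀ (x : A) a b → a ++ x ∷ b ≡ insertAt x (length a) (a ++ b)
++-∷≡insertAt x []      b = refl
++-∷≡insertAt x (y ∷ a) b = cong (y ∷_) (++-∷≡insertAt x a b)

insertions≡map-insertAt : ∀ x v → insertions x v ≡ map (λ k → insertAt x k v) (upTo (suc (length v)))
insertions≡map-insertAt x []       = refl
insertions≡map-insertAt x (y ∷ ys) = cong ((x ∷ y ∷ ys) ∷_) (begin
    map (y ∷_) (insertions x ys)
      ≡⟨ cong (map (y ∷_)) (insertions≡map-insertAt x ys) ⟩
    map (y ∷_) (map (λ k → insertAt x k ys) (upTo m))
      ≡⟨ LP.map-∘ (upTo m) ⟨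
    map (λ k → insertAt x (suc k) (y ∷ ys)) (upTo m)
      ≡⟨ LP.map-∘ (upTo m) ⟩
    map (λ k → insertAt x k (y ∷ ys)) (map suc (upTo m))
      ≡⟨ cong (map _) (LP.map-upTo suc m) ⟩
    map (λ k → insertAt x k (y ∷ ys)) (applyUpTo suc m) ∎)
  where
  open ≡-Reasoning
  m = suc (length ys)

∈-insertions⁺ : ∀ x k v → k ≤ length v → insertAt x k v ∈ insertions x v
∈-insertions⁺ x k v k≤ rewrite insertions≡map-insertAt x v = ∈P.∈-map⁺ _ (∈P.∈-upTo⁺ (s≤s k≤))

∈-insertions⁻ : ∀ {x v w} → w ∈ insertions x v → ∃ λ k → k ≤ length v × w ≡ insertAt x k v
∈-insertions⁻ {x} {v} p rewrite insertions≡map-insertAt x v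
  with k , k∈ , refl ← ∈P.∈-map⁻ _ p = k , ℕ.s≤s⁻¹ (∈P.∈-upTo⁻ k∈) , refl

∈-perms-suc⁺ : ∀ {n v} k → v ∈ perms n → k ≤ length v → insertAt (suc n) k v ∈ perms (suc n)
∈-perms-suc⁺ {n} {v} k v∈ k≤ = ∈P.∈-concatMap⁺ (insertions (suc n)) (lose v∈ (∈-insertions⁺ (suc n) k v k≤))

∈-perms-suc⁻ : ∀ {n w} → w ∈ perms (suc n) → ∃₂ λ k v → v ∈ perms n × k ≤ length v × w ≡ insertAt (suc n) k v
∈-perms-suc⁻ {n} p with v , v∈ , w∈ ← find (∈P.∈-concatMap⁻ (insertions (suc n)) p)
  with k , k≤ , refl ← ∈-insertions⁻ w∈ = k , v , v∈ , k≤ , refl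

∈-perms⁻ : ∀ n {w} → w ∈ perms n → w ↭ oneTo n
∈-perms⁻ zero    (here refl) = ↭-refl
∈-perms⁻ (suc n) p with k , v , v∈ , _ , refl ← ∈-perms-suc⁻ {n} p = begin
  insertAt (suc n) k v
    ↭⟨ insertAt-↭ (suc n) k v ⟩
  suc n ∷ v
    ↭⟨ prep (suc n) (∈-perms⁻ n v∈) ⟩
  suc n ∷ oneTo n
    ↭⟨ ↭P.∷↭∷ʳ (suc n) (oneTo n) ⟩
  oneTo n ∷ʳ suc n
    ≡⟨ oneTo-suc n ⟨
  oneTo (suc n) ∎
  where open ↭.PermutationReasoning

suc∈-↭-oneTo : ∀ {n w} → w ↭ oneTo (suc n) → suc n ∈ w
suc∈-↭-oneTo {n} p =
  ↭P.∈-resp-↭ (↭-sym p) (subst (suc n ∈_) (sym (oneTo-suc n)) (∈P.∈-++⁺ʳ (oneTo n) (here refl)))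

∈-perms⁺ : ∀ n {w} → w ↭ oneTo n → w ∈ perms n
∈-perms⁺ zero    {[]}    p = here refl
∈-perms⁺ zero    {_ ∷ _} p with () ← ↭P.↭-length p
∈-perms⁺ (suc n) p with a , b , refl ← ∈P.∈-∃++ (suc∈-↭-oneTo p) =
  subst (_∈ perms (suc n)) (sym (++-∷≡insertAt (suc n) a b))
    (∈-perms-suc⁺ (length a) (∈-perms⁺ n ab↭oneTo) (LP.length-++-≤ˡ a))
  where
  ab↭oneTo : a ++ b ↭ oneTo n
  ab↭oneTo = ↭-trans (↭P.drop-mid a (oneTo n) (↭-trans p (↭-reflexive (oneTo-suc n))))
                     (↭-reflexive (LP.++-identityʳ (oneTo n)))

length-∈-perms : ∀ n {w} → w ∈ perms n → length w ≡ n
length-∈-perms n p = trans (↭P.↭-length (∈-perms⁻ n p)) (length-oneTo n)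

erase : ℕ → List ℕ → List ℕ
erase x []       = []
erase x (y ∷ ys) with y ℕ.≟ x
... | yes _ = ys
... | no  _ = y ∷ erase x ys

erase-∷ : ∀ x v → erase x (x ∷ v) ≡ v
erase-∷ x v with x ℕ.≟ x
... | yes _   = refl
... | no  x≢x = ⊥-elim (x≢x refl)

erase-insertAt : ∀ x k v → x ∉ v → erase x (insertAt x k v) ≡ v
erase-insertAt x zero    v        _  = erase-∷ x v
erase-insertAt x (suc k) []       _  = erase-∷ x []
erase-insertAt x (suc k) (y ∷ ys) x∉ with y ℕ.≟ x
... | yes refl = ⊥-elim (x∉ (here refl))
... | no  _    = cong (y ∷_) (erase-insertAt x k ys (x∉ ∘ there))

insertions-unique : ∀ x v → x ∉ v → Unique (insertions x v)
insertions-unique x []       _  = [] ∷ []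
insertions-unique x (y ∷ ys) x∉ =
  All.tabulate new≢old ∷ UniqueP.map⁺ (λ { refl → refl }) (insertions-unique x ys (x∉ ∘ there))
  where
  new≢old : ∀ {w} → w ∈ map (y ∷_) (insertions x ys) → (x ∷ y ∷ ys) ≢ w
  new≢old w∈ refl with _ , _ , eq ← ∈P.∈-map⁻ (y ∷_) w∈ = x∉ (here (proj₁ (LP.∷-injective eq)))

concatMap-unique : ∀ (f : A → List B) (g : B → A) {xs} → Unique xs → (∀ {x} → x ∈ xs → Unique (f x)) →
                   (∀ {x w} → x ∈ xs → w ∈ f x → g w ≡ x) → Unique (concatMap f xs)
concatMap-unique f g {[]}     _           _      _    = []
concatMap-unique f g {x ∷ xs} (x∉ ∷ uxs) unique ginv =
  UniqueP.++⁺ (unique (here refl)) (concatMap-unique f g uxs (unique ∘ there) (ginv ∘ there)) disjoint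
  where
  disjoint : ∀ {w} → ¬ (w ∈ f x × w ∈ concatMap f xs)
  disjoint (w∈fx , w∈rest) with y , y∈ , w∈fy ← find (∈P.∈-concatMap⁻ f w∈rest) =
    All.lookup x∉ y∈ (trans (sym (ginv (here refl) w∈fx)) (ginv (there y∈) w∈fy))

perms-unique : ∀ n → Unique (perms n)
perms-unique zero    = [] ∷ []
perms-unique (suc n) =
  concatMap-unique (insertions (suc n)) (erase (suc n)) (perms-unique n)
    (λ {v} v∈ → insertions-unique (suc n) v (max∉ v∈))
    (λ {v} v∈ w∈ → let k , _ , w≡ = ∈-insertions⁻ w∈ in
      trans (cong (erase (suc n)) w≡) (erase-insertAt (suc n) k v (max∉ v∈)))
  where
  max∉ : ∀ {v} → v ∈ perms n → suc n ∉ v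
  max∉ v∈ n∈ = suc∉oneTo n (↭P.∈-resp-↭ (∈-perms⁻ n v∈) n∈)

moveToEnd : ℕ → List A → List A
moveToEnd k       []       = []
moveToEnd zero    (y ∷ ys) = ys ∷ʳ y
moveToEnd (suc k) (y ∷ ys) = y ∷ moveToEnd k ys

moveToEnd-↭ : ∀ k (v : List A) → moveToEnd k v ↭ v
moveToEnd-↭ k       []       = ↭-refl
moveToEnd-↭ zero    (y ∷ ys) = ↭-sym (↭P.∷↭∷ʳ y ys)
moveToEnd-↭ (suc k) (y ∷ ys) = prep y (moveToEnd-↭ k ys)

moveToEnd-injective : ∀ k {u v : List A} → moveToEnd k u ≡ moveToEnd k v → u ≡ v
moveToEnd-injective k       {[]}     {[]}     _  = refl
moveToEnd-injective zero    {[]}     {_ ∷ []} ()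
moveToEnd-injective zero    {[]}     {_ ∷ _ ∷ _} ()
moveToEnd-injective zero    {_ ∷ []} {[]} ()
moveToEnd-injective zero    {_ ∷ _ ∷ _} {[]} ()
moveToEnd-injective zero    {y ∷ ys} {z ∷ zs} eq with refl , refl ← LP.∷ʳ-injective ys zs eq = refl
moveToEnd-injective (suc k) {y ∷ ys} {z ∷ zs} eq with refl , eq′ ← LP.∷-injective eq =
  cong (y ∷_) (moveToEnd-injective k eq′)

moveToEnd-surjective : ∀ k (v : List A) → k < length v → ∃ λ u → u ↭ v × moveToEnd k u ≡ v
moveToEnd-surjective zero    v        k< with initLast v
... | []       = ⊥-elim (ℕP.<-irrefl refl k<)
... | xs ∷ʳ′ x = x ∷ xs , ↭P.∷↭∷ʳ x xs , refl
moveToEnd-surjective (suc k) (y ∷ ys) (s≤s k<) with u , u↭ , refl ← moveToEnd-surjective k ys k< =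
  y ∷ u , prep y u↭ , refl

map-moveToEnd-perms : ∀ {n k} → k < n → map (moveToEnd k) (perms n) ↭ perms n
map-moveToEnd-perms {n} {k} k<n =
  ∼bag⇒↭ (unique∧set⇒bag (UniqueP.map⁺ (moveToEnd-injective k) (perms-unique n)) (perms-unique n) (mk⇔ to from))
  where
  to : ∀ {w} → w ∈ map (moveToEnd k) (perms n) → w ∈ perms n
  to w∈ with v , v∈ , refl ← ∈P.∈-map⁻ (moveToEnd k) w∈ = ∈-perms⁺ n (↭-trans (moveToEnd-↭ k v) (∈-perms⁻ n v∈))
  from : ∀ {w} → w ∈ perms n → w ∈ map (moveToEnd k) (perms n)
  from {w} w∈ with u , u↭w , refl ← moveToEnd-surjective k w (subst (k <_) (sym (length-∈-perms n w∈)) k<n) =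
    ∈P.∈-map⁺ (moveToEnd k) (∈-perms⁺ n (↭-trans u↭w (∈-perms⁻ n w∈)))

-- In one-line notation, cycleInsert x k σ sends k+1 to x and x to σ(k+1):
-- the new letter x is spliced into the cycle of σ right after k+1.
cycleInsert : A → ℕ → List A → List A
cycleInsert x k σ = insertAt x k (moveToEnd k σ)

∑-insertions : ∀ x v F → ∑ (insertions x v) F ≡ ∑ (upTo (length v)) (λ k → F (insertAt x k v)) + F (v ∷ʳ x)
∑-insertions x v F = begin
  ∑ (insertions x v) F
    ≡⟨ cong (λ ws → ∑ ws F) (insertions≡map-insertAt x v) ⟩
  ∑ (map G (upTo (suc (length v)))) F
    ≡⟨ ∑-map G (upTo (suc (length v))) F ⟩
  ∑ (upTo (suc (length v))) (F ∘ G)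
    ≡⟨ cong (λ ks → ∑ ks (F ∘ G)) (LP.upTo-∷ʳ (length v)) ⟨
  ∑ (upTo (length v) ∷ʳ length v) (F ∘ G)
    ≡⟨ ∑-++ (upTo (length v)) [ length v ] (F ∘ G) ⟩
  ∑ (upTo (length v)) (F ∘ G) + (F (G (length v)) + 0)
    ≡⟨ cong (∑ (upTo (length v)) (F ∘ G) +_) (trans (ℕP.+-identityʳ _) (cong F (insertAt-length x v))) ⟩
  ∑ (upTo (length v)) (F ∘ G) + F (v ∷ʳ x) ∎
  where
  open ≡-Reasoning
  G : ℕ → List ℕ
  G k = insertAt x k v

∑-cycleInsert-perms : ∀ {n k} (F : List ℕ → ℕ) → k < n →
                      ∑ (perms n) (λ σ → F (cycleInsert (suc n) k σ)) ≡ ∑ (perms n) (λ σ → F (insertAt (suc n) k σ))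
∑-cycleInsert-perms {n} {k} F k<n =
  trans (sym (∑-map (moveToEnd k) (perms n) (λ σ → F (insertAt (suc n) k σ))))
        (∑-↭ (λ σ → F (insertAt (suc n) k σ)) (map-moveToEnd-perms k<n))

∑-perms-suc : ∀ n F → ∑ (perms (suc n)) F ≡
              ∑ (perms n) (λ σ → ∑ (upTo n) (λ k → F (cycleInsert (suc n) k σ)) + F (σ ∷ʳ suc n))
∑-perms-suc n F = begin
  ∑ (perms (suc n)) F
    ≡⟨ ∑-concatMap (insertions N) (perms n) F ⟩
  ∑ (perms n) (λ σ → ∑ (insertions N σ) F)
    ≡⟨ ∑-cong (perms n) split ⟩
  ∑ (perms n) (λ σ → Ins σ + Last σ)
    ≡⟨ ∑-+ (perms n) Ins Last ⟩
  ∑ (perms n) Ins + ∑ (perms n) Last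
    ≡⟨ cong (_+ ∑ (perms n) Last) rotate ⟩
  ∑ (perms n) Cyc + ∑ (perms n) Last
    ≡⟨ ∑-+ (perms n) Cyc Last ⟨
  ∑ (perms n) (λ σ → Cyc σ + Last σ) ∎
  where
  open ≡-Reasoning
  N = suc n
  Ins Cyc Last : List ℕ → ℕ
  Ins  σ = ∑ (upTo n) (λ k → F (insertAt N k σ))
  Cyc  σ = ∑ (upTo n) (λ k → F (cycleInsert N k σ))
  Last σ = F (σ ∷ʳ N)
  split : ∀ σ → σ ∈ perms n → ∑ (insertions N σ) F ≡ Ins σ + Last σ
  split σ σ∈ =
    trans (∑-insertions N σ F) (cong (λ m → ∑ (upTo m) (λ k → F (insertAt N k σ)) + Last σ) (length-∈-perms n σ∈))
  rotate : ∑ (perms n) Ins ≡ ∑ (perms n) Cyc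
  rotate = begin
    ∑ (perms n) Ins
      ≡⟨ ∑-comm (perms n) (upTo n) _ ⟩
    ∑ (upTo n) (λ k → ∑ (perms n) (λ σ → F (insertAt N k σ)))
      ≡⟨ ∑-cong (upTo n) (λ k k∈ → sym (∑-cycleInsert-perms F (∈P.∈-upTo⁻ k∈))) ⟩
    ∑ (upTo n) (λ k → ∑ (perms n) (λ σ → F (cycleInsert N k σ)))
      ≡⟨ ∑-comm (perms n) (upTo n) _ ⟨
    ∑ (perms n) Cyc ∎

perms-ind : (P : ℕ → List ℕ → Set) → P 0 [] →
            (∀ {n σ} → σ ∈ perms n → P n σ → P (suc n) (σ ∷ʳ suc n)) →
            (∀ {n k σ} → k < n → σ ∈ perms n → P n σ → P (suc n) (cycleInsert (suc n) k σ)) →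
            ∀ n {σ} → σ ∈ perms n → P n σ
perms-ind P P[] Pappend Pcycle zero    (here refl) = P[]
perms-ind P P[] Pappend Pcycle (suc n) σ∈
  with k , v , v∈ , k≤ , refl ← ∈-perms-suc⁻ {n} σ∈ | ℕP.m≤n⇒m<n∨m≡n k≤
... | inj₂ refl rewrite insertAt-length (suc n) v = Pappend v∈ (perms-ind P P[] Pappend Pcycle n v∈)
... | inj₁ k<len with u , u↭v , refl ← moveToEnd-surjective k v k<len =
  Pcycle k<n u∈ (perms-ind P P[] Pappend Pcycle n u∈)
  where
  k<n : k < n
  k<n = subst (k <_) (length-∈-perms n v∈) k<len
  u∈ : u ∈ perms n
  u∈ = ∈-perms⁺ n (↭-trans u↭v (∈-perms⁻ n v∈))

-- Cycles and Flatten

true-if-T : ∀ {b} → T b → b ≡ true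
true-if-T {true} _ = refl

false-if-¬T : ∀ {b} → ¬ T b → b ≡ false
false-if-¬T {false} _  = refl
false-if-¬T {true}  ¬t = ⊥-elim (¬t _)

≡ᵇ-≡-true : ∀ {m n} → m ≡ n → (m ≡ᵇ n) ≡ true
≡ᵇ-≡-true {m} {n} m≡n = true-if-T (ℕP.≡⇒≡ᵇ m n m≡n)

≡ᵇ-≢-false : ∀ {m n} → m ≢ n → (m ≡ᵇ n) ≡ false
≡ᵇ-≢-false {m} {n} m≢n = false-if-¬T (m≢n ∘ ℕP.≡ᵇ⇒≡ m n)

<ᵇ-true : ∀ {m n} → m < n → (m <ᵇ n) ≡ true
<ᵇ-true m<n = true-if-T (ℕP.<⇒<ᵇ m<n)

<ᵇ-false : ∀ {m n} → n ≤ m → (m <ᵇ n) ≡ false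
<ᵇ-false {m} {n} n≤m = false-if-¬T (ℕP.≤⇒≯ n≤m ∘ ℕP.<ᵇ⇒< m n)

elem-∈ : ∀ {x xs} → x ∈ xs → elem x xs ≡ true
elem-∈ {x} {y ∷ xs} (here refl) rewrite ≡ᵇ-≡-true {x} refl = refl
elem-∈ {x} {y ∷ xs} (there x∈) rewrite elem-∈ x∈ = BoolP.∨-zeroʳ (x ≡ᵇ y)

elem-∉ : ∀ {x xs} → x ∉ xs → elem x xs ≡ false
elem-∉ {x} {[]}     _  = refl
elem-∉ {x} {y ∷ xs} x∉ rewrite ≡ᵇ-≢-false (x∉ ∘ here) = elem-∉ (x∉ ∘ there)

insertAfter : ℕ → ℕ → List ℕ → List ℕ
insertAfter i x []       = []
insertAfter i x (y ∷ ys) with y ℕ.≟ i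
... | yes _ = y ∷ x ∷ insertAfter i x ys
... | no  _ = y ∷ insertAfter i x ys

insertAfter-∉ : ∀ i x ys → i ∉ ys → insertAfter i x ys ≡ ys
insertAfter-∉ i x []       _  = refl
insertAfter-∉ i x (y ∷ ys) i∉ with y ℕ.≟ i
... | yes refl = ⊥-elim (i∉ (here refl))
... | no  _    = cong (y ∷_) (insertAfter-∉ i x ys (i∉ ∘ there))

insertAfter-here : ∀ i x ys → i ∉ ys → insertAfter i x (i ∷ ys) ≡ i ∷ x ∷ ys
insertAfter-here i x ys i∉ with i ℕ.≟ i
... | yes _   = cong (λ zs → i ∷ x ∷ zs) (insertAfter-∉ i x ys i∉)
... | no  i≢i = ⊥-elim (i≢i refl)

insertAfter-there : ∀ i x y ys → y ≢ i → insertAfter i x (y ∷ ys) ≡ y ∷ insertAfter i x ys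
insertAfter-there i x y ys y≢i with y ℕ.≟ i
... | yes y≡i = ⊥-elim (y≢i y≡i)
... | no  _   = refl

insertAfter-++ : ∀ i x ys zs → insertAfter i x (ys ++ zs) ≡ insertAfter i x ys ++ insertAfter i x zs
insertAfter-++ i x []       zs = refl
insertAfter-++ i x (y ∷ ys) zs with y ℕ.≟ i
... | yes _ = cong (λ ws → y ∷ x ∷ ws) (insertAfter-++ i x ys zs)
... | no  _ = cong (y ∷_) (insertAfter-++ i x ys zs)

∈-insertAfter⁻ : ∀ {i x z} ys → z ∈ insertAfter i x ys → z ∈ ys ⊎ z ≡ x
∈-insertAfter⁻ {i} (y ∷ ys) z∈ with y ℕ.≟ i | z∈
... | yes _ | here z≡y                 = inj₁ (here z≡y)
... | yes _ | there (here z≡x)         = inj₂ z≡x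
... | yes _ | there (there z∈′)        = Sum.map₁ there (∈-insertAfter⁻ ys z∈′)
... | no  _ | here z≡y                 = inj₁ (here z≡y)
... | no  _ | there z∈′                = Sum.map₁ there (∈-insertAfter⁻ ys z∈′)

∈-insertAfter⁺ : ∀ {i} x ys → i ∈ ys → x ∈ insertAfter i x ys
∈-insertAfter⁺ {i} x (y ∷ ys) i∈ with y ℕ.≟ i | i∈
... | yes _   | _          = there (here refl)
... | no  y≢i | here i≡y   = ⊥-elim (y≢i (sym i≡y))
... | no  _   | there i∈′  = there (∈-insertAfter⁺ x ys i∈′)

elem-insertAfter : ∀ {i x j} ys → j ≢ x → elem j (insertAfter i x ys) ≡ elem j ys
elem-insertAfter {i} {x} {j} []       _   = refl
elem-insertAfter {i} {x} {j} (y ∷ ys) j≢x with y ℕ.≟ i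
... | yes _ rewrite ≡ᵇ-≢-false j≢x = cong ((j ≡ᵇ y) ∨_) (elem-insertAfter ys j≢x)
... | no  _ = cong ((j ≡ᵇ y) ∨_) (elem-insertAfter ys j≢x)

insertAfter-↭ : ∀ {i} x ys → Unique ys → i ∈ ys → insertAfter i x ys ↭ x ∷ ys
insertAfter-↭ {i} x (y ∷ ys) (y∉ ∷ u) i∈ with y ℕ.≟ i | i∈
... | yes refl | _         rewrite insertAfter-∉ y x ys (UniqueP.Unique[x∷xs]⇒x∉xs (y∉ ∷ u)) = swap y x ↭-refl
... | no  y≢i  | here i≡y  = ⊥-elim (y≢i (sym i≡y))
... | no  _    | there i∈′ = ↭-trans (prep y (insertAfter-↭ x ys u i∈′)) (swap y x ↭-refl)

insertAfter-unique : ∀ {i x} ys → x ∉ ys → Unique ys → Unique (insertAfter i x ys)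
insertAfter-unique {i} {x} []       _  _          = []
insertAfter-unique {i} {x} (y ∷ ys) x∉ (y∉ ∷ u) with y ℕ.≟ i
... | yes refl rewrite insertAfter-∉ y x ys (UniqueP.Unique[x∷xs]⇒x∉xs (y∉ ∷ u)) =
  ((x∉ ∘ here ∘ sym) ∷ y∉) ∷ All.tabulate (λ { z∈ refl → x∉ (there z∈) }) ∷ u
... | no  _ = All.tabulate y≢ ∷ insertAfter-unique ys (x∉ ∘ there) u
  where
  y≢ : ∀ {z} → z ∈ insertAfter i x ys → y ≢ z
  y≢ z∈ y≡z with ∈-insertAfter⁻ ys z∈
  ... | inj₁ z∈ys = All.lookup y∉ z∈ys y≡z
  ... | inj₂ z≡x  = x∉ (here (trans (sym z≡x) (sym y≡z)))

length-insertAfter : ∀ {i x} ys → Unique ys → length (insertAfter i x ys) ≤ suc (length ys)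
length-insertAfter {i} {x} []       _          = z≤n
length-insertAfter {i} {x} (y ∷ ys) (y∉ ∷ u) with y ℕ.≟ i
... | yes refl rewrite insertAfter-∉ y x ys (UniqueP.Unique[x∷xs]⇒x∉xs (y∉ ∷ u)) = ℕP.≤-refl
... | no  _    = s≤s (length-insertAfter ys u)

insertAfter-bounded : ∀ {i n} ys → All (_≤ n) ys → All (_≤ suc n) (insertAfter i (suc n) ys)
insertAfter-bounded ys ys≤n =
  All.tabulate λ z∈ → [ ℕP.m≤n⇒m≤1+n ∘ All.lookup ys≤n , ℕP.≤-reflexive ]′ (∈-insertAfter⁻ ys z∈)

data Orbit (p : ℕ → ℕ) (s : ℕ) : ℕ → List ℕ → Set where
  done : ∀ {c}     → p c ≡ s → Orbit p s c [ c ]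
  next : ∀ {c d L} → p c ≡ d → d ≢ s → Orbit p s d L → Orbit p s c (c ∷ L)

orbit-head : ∀ {p s c L} {P : ℕ → Set} → Orbit p s c L → All P L → P c
orbit-head (done _)     (pc ∷ _) = pc
orbit-head (next _ _ _) (pc ∷ _) = pc

orbit-cong : ∀ {p p′ s c L} → All (λ y → p′ y ≡ p y) L → Orbit p s c L → Orbit p′ s c L
orbit-cong (p′c ∷ []) (done pc)       = done (trans p′c pc)
orbit-cong (p′c ∷ eq) (next pc d≢s o) = next (trans p′c pc) d≢s (orbit-cong eq o)

cycleFrom-orbit : ∀ {σ s c L} fuel → Orbit (apply σ) s c L → length L ≤ fuel → cycleFrom σ fuel s c ≡ L
cycleFrom-orbit (suc fuel) (done pc≡s) _ rewrite ≡ᵇ-≡-true pc≡s = refl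
cycleFrom-orbit {σ} {s} {c} (suc fuel) (next pc≡d d≢s o) (s≤s L≤) rewrite pc≡d | ≡ᵇ-≢-false d≢s =
  cong (c ∷_) (cycleFrom-orbit fuel o L≤)

record Cycle (n : ℕ) (p : ℕ → ℕ) (j : ℕ) : Set where
  constructor cycle
  field
    letters  : List ℕ
    orbit    : Orbit p j j letters
    short    : length letters ≤ n
    distinct : Unique letters
    bounded  : All (_≤ n) letters

Cycles : ℕ → (ℕ → ℕ) → Set
Cycles n p = ∀ {j} → 1 ≤ j → j ≤ n → Cycle n p j

cycles-zero : ∀ p → Cycles 0 p
cycles-zero p 1≤j j≤0 = ⊥-elim (ℕP.<-irrefl refl (ℕP.≤-trans 1≤j j≤0))

module SpliceIntoCycle (p p′ : ℕ → ℕ) {n i : ℕ} (1≤i : 1 ≤ i) (i≤n : i ≤ n)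
         (p′i : p′ i ≡ suc n) (p′N : p′ (suc n) ≡ p i) (p′y : ∀ {y} → y ≤ n → y ≢ i → p′ y ≡ p y) where

  private
    N = suc n

    ≤n⇒≢N : ∀ {y} → y ≤ n → y ≢ N
    ≤n⇒≢N y≤n refl = ℕP.<-irrefl refl y≤n

  orbit-insertAfter : ∀ {s c L} → s ≢ N → Orbit p s c L → All (_≤ n) L → Orbit p′ s c (insertAfter i N L)
  orbit-insertAfter s≢N (done {c} pc≡s) (c≤n ∷ []) with c ℕ.≟ i
  ... | yes refl = next p′i (s≢N ∘ sym) (done (trans p′N pc≡s))
  ... | no  c≢i  = done (trans (p′y c≤n c≢i) pc≡s)
  orbit-insertAfter s≢N (next {c} pc≡d d≢s o) (c≤n ∷ L≤n) with c ℕ.≟ i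
  ... | yes refl = next p′i (s≢N ∘ sym) (next (trans p′N pc≡d) d≢s (orbit-insertAfter s≢N o L≤n))
  ... | no  c≢i  = next (trans (p′y c≤n c≢i) pc≡d) d≢s (orbit-insertAfter s≢N o L≤n)

  orbit-to-new : ∀ {c L} → Orbit p i c L → All (_≤ n) L → i ∉ L → Orbit p′ N c (L ∷ʳ i)
  orbit-to-new (done {c} pc≡i) (c≤n ∷ []) i∉ =
    next (trans (p′y c≤n (i∉ ∘ here ∘ sym)) pc≡i) (≤n⇒≢N i≤n) (done p′i)
  orbit-to-new (next {c} pc≡d d≢i o) (c≤n ∷ L≤n) i∉ =
    next (trans (p′y c≤n (i∉ ∘ here ∘ sym)) pc≡d) (≤n⇒≢N (orbit-head o L≤n)) (orbit-to-new o L≤n (i∉ ∘ there))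

  cycle-of-new : Cycle n p i → Cycle N p′ N
  cycle-of-new (cycle (i ∷ []) (done pi≡i) short _ _) =
    cycle (N ∷ i ∷ []) (next (trans p′N pi≡i) (≤n⇒≢N i≤n) (done p′i)) (s≤s short)
          (((≤n⇒≢N i≤n ∘ sym) ∷ []) ∷ [] ∷ []) (ℕP.≤-refl ∷ ℕP.m≤n⇒m≤1+n i≤n ∷ [])
  cycle-of-new (cycle (i ∷ L) (next pi≡d d≢i o) short (i∉ ∷ u) (_ ∷ L≤n)) =
    cycle (N ∷ (L ∷ʳ i)) (next (trans p′N pi≡d) (≤n⇒≢N (orbit-head o L≤n)) (orbit-to-new o L≤n i∉L))
          (s≤s (subst (_≤ n) (trans (ℕP.+-comm 1 (length L)) (sym (LP.length-++ L))) short))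
          (All.tabulate (λ z∈ → ≤n⇒≢N (All.lookup Li≤n z∈) ∘ sym) ∷ Unique-resp-↭ Li↭ (i∉ ∷ u))
          (ℕP.≤-refl ∷ All.map ℕP.m≤n⇒m≤1+n Li≤n)
    where
    i∉L : i ∉ L
    i∉L = UniqueP.Unique[x∷xs]⇒x∉xs (i∉ ∷ u)
    Li↭ : i ∷ L ↭ L ∷ʳ i
    Li↭ = ↭P.∷↭∷ʳ i L
    Li≤n : All (_≤ n) (L ∷ʳ i)
    Li≤n = ↭P.All-resp-↭ Li↭ (i≤n ∷ L≤n)

  cycle-splice-old : ∀ {j} → j ≤ n → (c : Cycle n p j) → Cycle N p′ j
  cycle-splice-old j≤n (cycle L orbit short distinct bounded) =
    cycle (insertAfter i N L) (orbit-insertAfter (≤n⇒≢N j≤n) orbit bounded)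
          (ℕP.≤-trans (length-insertAfter L distinct) (s≤s short))
          (insertAfter-unique L (λ N∈ → ≤n⇒≢N (All.lookup bounded N∈) refl) distinct) (insertAfter-bounded L bounded)

  cycles-splice : Cycles n p → Cycles N p′
  cycles-splice cycles 1≤j j≤N with ℕP.m≤n⇒m<n∨m≡n j≤N
  ... | inj₂ refl       = cycle-of-new (cycles 1≤i i≤n)
  ... | inj₁ (s≤s j≤n) = cycle-splice-old j≤n (cycles 1≤j j≤n)

cycle-extend-old : ∀ {p p′ n j} → (∀ {y} → y ≤ n → p′ y ≡ p y) → Cycle n p j → Cycle (suc n) p′ j
cycle-extend-old p′y (cycle L orbit short distinct bounded) =
  cycle L (orbit-cong (All.map p′y bounded) orbit) (ℕP.m≤n⇒m≤1+n short) distinct (All.map ℕP.m≤n⇒m≤1+n bounded)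

cycles-extend : ∀ {p p′ n} → p′ (suc n) ≡ suc n → (∀ {y} → y ≤ n → p′ y ≡ p y) → Cycles n p → Cycles (suc n) p′
cycles-extend {n = n} p′N p′y cycles 1≤j j≤N with ℕP.m≤n⇒m<n∨m≡n j≤N
... | inj₂ refl       = cycle [ suc n ] (done p′N) (s≤s z≤n) ([] ∷ []) (ℕP.≤-refl ∷ [])
... | inj₁ (s≤s j≤n) = cycle-extend-old p′y (cycles 1≤j j≤n)

apply-zero : ∀ σ → apply σ 0 ≡ 0
apply-zero []      = refl
apply-zero (_ ∷ _) = refl

apply-∷ʳ-new : ∀ σ x → apply (σ ∷ʳ x) (suc (length σ)) ≡ x
apply-∷ʳ-new []           x = refl
apply-∷ʳ-new (y ∷ [])     x = refl
apply-∷ʳ-new (y ∷ z ∷ zs) x = apply-∷ʳ-new (z ∷ zs) x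

apply-∷ʳ-old : ∀ σ x {y} → y ≤ length σ → apply (σ ∷ʳ x) y ≡ apply σ y
apply-∷ʳ-old σ            x {zero}        _         = trans (apply-zero (σ ∷ʳ x)) (sym (apply-zero σ))
apply-∷ʳ-old (z ∷ zs)     x {suc zero}    _         = refl
apply-∷ʳ-old (z ∷ zs)     x {suc (suc y)} (s≤s y<) = apply-∷ʳ-old zs x y<

apply-cycleInsert-self : ∀ x k σ → k < length σ → apply (cycleInsert x k σ) (suc k) ≡ x
apply-cycleInsert-self x zero    (z ∷ zs) _        = refl
apply-cycleInsert-self x (suc k) (z ∷ zs) (s≤s k<) = apply-cycleInsert-self x k zs k<

apply-cycleInsert-new : ∀ x k σ → k < length σ → apply (cycleInsert x k σ) (suc (length σ)) ≡ apply σ (suc k)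
apply-cycleInsert-new x zero    (z ∷ zs) _        = apply-∷ʳ-new zs z
apply-cycleInsert-new x (suc k) (z ∷ zs) (s≤s k<) = apply-cycleInsert-new x k zs k<

apply-cycleInsert-old : ∀ x k σ {y} → y ≤ length σ → y ≢ suc k → apply (cycleInsert x k σ) y ≡ apply σ y
apply-cycleInsert-old x k       σ        {zero}        _        _    =
  trans (apply-zero (cycleInsert x k σ)) (sym (apply-zero σ))
apply-cycleInsert-old x zero    (z ∷ zs) {suc zero}    _        y≢1  = ⊥-elim (y≢1 refl)
apply-cycleInsert-old x zero    (z ∷ zs) {suc (suc y)} (s≤s y<) _    = apply-∷ʳ-old zs z y<
apply-cycleInsert-old x (suc k) (z ∷ zs) {suc zero}    _        _    = refl
apply-cycleInsert-old x (suc k) (z ∷ zs) {suc (suc y)} (s≤s y<) y≢k = apply-cycleInsert-old x k zs y< (y≢k ∘ cong suc)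

cycleFrom-cycle : ∀ {σ n j} → (c : Cycle n (apply σ) j) → cycleFrom σ n j j ≡ Cycle.letters c
cycleFrom-cycle {n = n} c = cycleFrom-orbit n (Cycle.orbit c) (Cycle.short c)

flattenFrom-++ : ∀ σ fuel xs ys acc →
                 flattenFrom σ fuel (xs ++ ys) acc ≡ flattenFrom σ fuel ys (flattenFrom σ fuel xs acc)
flattenFrom-++ σ fuel []       ys acc = refl
flattenFrom-++ σ fuel (x ∷ xs) ys acc with elem x acc
... | true  = flattenFrom-++ σ fuel xs ys acc
... | false = flattenFrom-++ σ fuel xs ys (acc ++ cycleFrom σ fuel x x)

flattenFrom-map : ∀ {σ σ′ m m′} (f : List ℕ → List ℕ) js acc →
                  (∀ xs ys → f (xs ++ ys) ≡ f xs ++ f ys) →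
                  (∀ {j} xs → j ∈ js → elem j (f xs) ≡ elem j xs) →
                  (∀ {j} → j ∈ js → cycleFrom σ′ m′ j j ≡ f (cycleFrom σ m j j)) →
                  flattenFrom σ′ m′ js (f acc) ≡ f (flattenFrom σ m js acc)
flattenFrom-map f []       acc f-++ f-elem f-cycle = refl
flattenFrom-map {σ} {m = m} f (j ∷ js) acc f-++ f-elem f-cycle rewrite f-elem acc (here refl) with elem j acc
... | true  = flattenFrom-map f js acc f-++ (λ xs → f-elem xs ∘ there) (f-cycle ∘ there)
... | false rewrite f-cycle (here refl) | sym (f-++ acc (cycleFrom σ m j j)) =
  flattenFrom-map f js (acc ++ cycleFrom σ m j j) f-++ (λ xs → f-elem xs ∘ there) (f-cycle ∘ there)

Flatten-suc : ∀ n σ → Flatten (suc n) σ ≡ flattenFrom σ (suc n) [ suc n ] (flattenFrom σ (suc n) (oneTo n) [])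
Flatten-suc n σ =
  trans (cong (λ js → flattenFrom σ (suc n) js []) (oneTo-suc n)) (flattenFrom-++ σ (suc n) (oneTo n) [ suc n ] [])

flattenFrom-seen : ∀ σ fuel {j acc} → elem j acc ≡ true → flattenFrom σ fuel [ j ] acc ≡ acc
flattenFrom-seen σ fuel seen rewrite seen = refl

flattenFrom-unseen : ∀ σ fuel {j acc} → elem j acc ≡ false → flattenFrom σ fuel [ j ] acc ≡ acc ++ cycleFrom σ fuel j j
flattenFrom-unseen σ fuel unseen rewrite unseen = refl

module _ {n k σ} (σ∈ : σ ∈ perms n) (k<n : k < n) (cycles : Cycles n (apply σ)) where

  private
    N = suc n
    σ′ = cycleInsert N k σ
    k<len : k < length σ
    k<len = subst (k <_) (sym (length-∈-perms n σ∈)) k<n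

  open SpliceIntoCycle (apply σ) (apply σ′) (s≤s z≤n) k<n (apply-cycleInsert-self N k σ k<len)
         (subst (λ m → apply σ′ (suc m) ≡ apply σ (suc k)) (length-∈-perms n σ∈) (apply-cycleInsert-new N k σ k<len))
         (λ y≤n → apply-cycleInsert-old N k σ (subst (_ ≤_) (sym (length-∈-perms n σ∈)) y≤n))

  cycles-cycleInsert : Cycles N (apply σ′)
  cycles-cycleInsert = cycles-splice cycles

  Flatten-cycleInsert : suc k ∈ Flatten n σ → Flatten N σ′ ≡ insertAfter (suc k) N (Flatten n σ)
  Flatten-cycleInsert i∈ = begin
    Flatten N σ′
      ≡⟨ Flatten-suc n σ′ ⟩
    flattenFrom σ′ N [ N ] (flattenFrom σ′ N (oneTo n) [])
      ≡⟨ cong (flattenFrom σ′ N [ N ]) scan ⟩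
    flattenFrom σ′ N [ N ] (insertAfter (suc k) N (Flatten n σ))
      ≡⟨ flattenFrom-seen σ′ N (elem-∈ (∈-insertAfter⁺ N _ i∈)) ⟩
    insertAfter (suc k) N (Flatten n σ) ∎
    where
    open ≡-Reasoning
    elem-same : ∀ {j} xs → j ∈ oneTo n → elem j (insertAfter (suc k) N xs) ≡ elem j xs
    elem-same {j} xs j∈ = elem-insertAfter {j = j} xs (λ { refl → suc∉oneTo n j∈ })
    cycle-same : ∀ {j} → j ∈ oneTo n → cycleFrom σ′ N j j ≡ insertAfter (suc k) N (cycleFrom σ n j j)
    cycle-same j∈ = let 1≤j , j≤n = ∈-oneTo⁻ j∈ ; c = cycles 1≤j j≤n in
      trans (cycleFrom-cycle (cycle-splice-old j≤n c)) (cong (insertAfter (suc k) N) (sym (cycleFrom-cycle c)))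
    scan : flattenFrom σ′ N (oneTo n) [] ≡ insertAfter (suc k) N (Flatten n σ)
    scan = flattenFrom-map (insertAfter (suc k) N) (oneTo n) [] (insertAfter-++ (suc k) N) elem-same cycle-same

module _ {n σ} (σ∈ : σ ∈ perms n) (cycles : Cycles n (apply σ)) where

  private
    N = suc n
    σ′ = σ ∷ʳ N
    old : ∀ {y} → y ≤ n → apply σ′ y ≡ apply σ y
    old y≤n = apply-∷ʳ-old σ N (subst (_ ≤_) (sym (length-∈-perms n σ∈)) y≤n)
    new : apply σ′ N ≡ N
    new = subst (λ m → apply σ′ (suc m) ≡ N) (length-∈-perms n σ∈) (apply-∷ʳ-new σ N)

  cycles-append : Cycles N (apply σ′)
  cycles-append = cycles-extend new old cycles

  Flatten-append : N ∉ Flatten n σ → Flatten N σ′ ≡ Flatten n σ ∷ʳ N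
  Flatten-append N∉ = begin
    Flatten N σ′
      ≡⟨ Flatten-suc n σ′ ⟩
    flattenFrom σ′ N [ N ] (flattenFrom σ′ N (oneTo n) [])
      ≡⟨ cong (flattenFrom σ′ N [ N ]) scan ⟩
    flattenFrom σ′ N [ N ] (Flatten n σ)
      ≡⟨ flattenFrom-unseen σ′ N (elem-∉ N∉) ⟩
    Flatten n σ ++ cycleFrom σ′ N N N
      ≡⟨ cong (Flatten n σ ++_) (cycleFrom-orbit N (done new) (s≤s z≤n)) ⟩
    Flatten n σ ∷ʳ N ∎
    where
    open ≡-Reasoning
    cycle-same : ∀ {j} → j ∈ oneTo n → cycleFrom σ′ N j j ≡ cycleFrom σ n j j
    cycle-same j∈ = let 1≤j , j≤n = ∈-oneTo⁻ j∈ ; c = cycles 1≤j j≤n in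
      trans (cycleFrom-cycle (cycle-extend-old old c)) (sym (cycleFrom-cycle c))
    scan : flattenFrom σ′ N (oneTo n) [] ≡ Flatten n σ
    scan = flattenFrom-map (λ xs → xs) (oneTo n) [] (λ _ _ → refl) (λ _ _ → refl) cycle-same

private
  FlattenInvariant : ℕ → List ℕ → Set
  FlattenInvariant n σ = Cycles n (apply σ) × Flatten n σ ↭ oneTo n

  flattenInvariant : ∀ n {σ} → σ ∈ perms n → FlattenInvariant n σ
  flattenInvariant = perms-ind FlattenInvariant (cycles-zero (apply []) , ↭-refl) append cycleIns
    where
    append : ∀ {n σ} → σ ∈ perms n → FlattenInvariant n σ → FlattenInvariant (suc n) (σ ∷ʳ suc n)
    append {n} {σ} σ∈ (cycles , flat↭) = cycles-append σ∈ cycles , (begin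
      Flatten (suc n) (σ ∷ʳ suc n)
        ≡⟨ Flatten-append σ∈ cycles (suc∉oneTo n ∘ ↭P.∈-resp-↭ flat↭) ⟩
      Flatten n σ ∷ʳ suc n
        ↭⟨ ↭P.++⁺ʳ [ suc n ] flat↭ ⟩
      oneTo n ∷ʳ suc n
        ≡⟨ oneTo-suc n ⟨
      oneTo (suc n) ∎)
      where open ↭.PermutationReasoning
    cycleIns : ∀ {n k σ} → k < n → σ ∈ perms n → FlattenInvariant n σ →
               FlattenInvariant (suc n) (cycleInsert (suc n) k σ)
    cycleIns {n} {k} {σ} k<n σ∈ (cycles , flat↭) = cycles-cycleInsert σ∈ k<n cycles , (begin
      Flatten (suc n) (cycleInsert (suc n) k σ)
        ≡⟨ Flatten-cycleInsert σ∈ k<n cycles i∈ ⟩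
      insertAfter (suc k) (suc n) (Flatten n σ)
        ↭⟨ insertAfter-↭ (suc n) (Flatten n σ) (Unique-resp-↭ (↭-sym flat↭) (oneTo-unique n)) i∈ ⟩
      suc n ∷ Flatten n σ
        ↭⟨ prep (suc n) flat↭ ⟩
      suc n ∷ oneTo n
        ↭⟨ ↭P.∷↭∷ʳ (suc n) (oneTo n) ⟩
      oneTo n ∷ʳ suc n
        ≡⟨ oneTo-suc n ⟨
      oneTo (suc n) ∎)
      where
      open ↭.PermutationReasoning
      i∈ : suc k ∈ Flatten n σ
      i∈ = ↭P.∈-resp-↭ (↭-sym flat↭) (∈-oneTo⁺ k<n)

Flatten-↭-oneTo : ∀ n {σ} → σ ∈ perms n → Flatten n σ ↭ oneTo n
Flatten-↭-oneTo n σ∈ = proj₂ (flattenInvariant n σ∈)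

Flatten-cycleInsert-perms : ∀ n {k σ} → k < n → σ ∈ perms n →
                            Flatten (suc n) (cycleInsert (suc n) k σ) ≡ insertAfter (suc k) (suc n) (Flatten n σ)
Flatten-cycleInsert-perms n k<n σ∈ =
  Flatten-cycleInsert σ∈ k<n (proj₁ (flattenInvariant n σ∈))
    (↭P.∈-resp-↭ (↭-sym (Flatten-↭-oneTo n σ∈)) (∈-oneTo⁺ k<n))

Flatten-append-perms : ∀ n {σ} → σ ∈ perms n → Flatten (suc n) (σ ∷ʳ suc n) ≡ Flatten n σ ∷ʳ suc n
Flatten-append-perms n σ∈ =
  Flatten-append σ∈ (proj₁ (flattenInvariant n σ∈)) (suc∉oneTo n ∘ ↭P.∈-resp-↭ (Flatten-↭-oneTo n σ∈))

-- Occurrences of 13-2 and non-inversions under insertion of a new maximum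

above : ℕ → ℕ → ℕ
above a c = if a <ᵇ c then 1 else 0

between : ℕ → ℕ → ℕ → ℕ
between a b c = if (a <ᵇ c) ∧ (c <ᵇ b) then 1 else 0

countBetween≡∑ : ∀ a b u → countBetween a b u ≡ ∑ u (between a b)
countBetween≡∑ a b []      = refl
countBetween≡∑ a b (c ∷ u) = cong (between a b c +_) (countBetween≡∑ a b u)

countAbove : ℕ → List ℕ → ℕ
countAbove a u = ∑ u (above a)

nonInversions : List ℕ → ℕ
nonInversions []      = 0
nonInversions (a ∷ u) = countAbove a u + nonInversions u

triangular : ℕ → ℕ
triangular zero    = 0
triangular (suc m) = suc m + triangular m

afterEach : A → List A → List (List A)
afterEach x []      = []
afterEach x (a ∷ r) = (a ∷ x ∷ r) ∷ map (a ∷_) (afterEach x r)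

∑-afterEach-∷ : ∀ (x a : A) r f → ∑ (afterEach x (a ∷ r)) f ≡ f (a ∷ x ∷ r) + ∑ (afterEach x r) (λ u → f (a ∷ u))
∑-afterEach-∷ x a r f = cong (f (a ∷ x ∷ r) +_) (∑-map (a ∷_) (afterEach x r) f)

∑-afterEach-∑ : ∀ (x : A) t w → ∑ (afterEach x t) (λ u → ∑ u w) ≡ length t * (w x + ∑ t w)
∑-afterEach-∑ x []      w = refl
∑-afterEach-∑ x (a ∷ r) w = begin
  ∑ (afterEach x (a ∷ r)) (λ u → ∑ u w)
    ≡⟨ ∑-afterEach-∷ x a r (λ u → ∑ u w) ⟩
  w a + (w x + ∑ r w) + ∑ (afterEach x r) (λ u → w a + ∑ u w)
    ≡⟨ cong (w a + (w x + ∑ r w) +_) (∑-+ (afterEach x r) (λ _ → w a) (λ u → ∑ u w)) ⟩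
  w a + (w x + ∑ r w) + (∑ (afterEach x r) (λ _ → w a) + ∑ (afterEach x r) (λ u → ∑ u w))
    ≡⟨ cong₂ (λ c s → w a + (w x + ∑ r w) + (c + s)) positions (∑-afterEach-∑ x r w) ⟩
  w a + (w x + ∑ r w) + (length r * w a + length r * (w x + ∑ r w))
    ≡⟨ regroup (w a) (w x) (∑ r w) (length r) ⟩
  suc (length r) * (w x + (w a + ∑ r w)) ∎
  where
  open ≡-Reasoning
  regroup : ∀ a x s l → a + (x + s) + (l * a + l * (x + s)) ≡ suc l * (x + (a + s))
  regroup = solve-∀
  length-afterEach : ∀ (x : A) r → length (afterEach x r) ≡ length r
  length-afterEach x []      = refl
  length-afterEach x (a ∷ r) = cong suc (trans (LP.length-map (a ∷_) (afterEach x r)) (length-afterEach x r))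
  positions : ∑ (afterEach x r) (λ _ → w a) ≡ length r * w a
  positions = trans (∑-const (afterEach x r) (w a)) (cong (_* w a) (length-afterEach x r))

map-insertAfter≡afterEach : ∀ x w → Unique w → map (λ i → insertAfter i x w) w ≡ afterEach x w
map-insertAfter≡afterEach x []      _          = refl
map-insertAfter≡afterEach x (a ∷ r) (a∉ ∷ u) =
  cong₂ _∷_ (insertAfter-here a x r (UniqueP.Unique[x∷xs]⇒x∉xs (a∉ ∷ u))) (begin
  map (λ i → insertAfter i x (a ∷ r)) r
    ≡⟨ LP.map-cong-local (All.map (λ a≢i → insertAfter-there _ x a r a≢i) a∉) ⟩
  map (λ i → a ∷ insertAfter i x r) r
    ≡⟨ LP.map-∘ r ⟩
  map (a ∷_) (map (λ i → insertAfter i x r) r)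
    ≡⟨ cong (map (a ∷_)) (map-insertAfter≡afterEach x r u) ⟩
  map (a ∷_) (afterEach x r) ∎)
  where open ≡-Reasoning

occ13-2-at : ℕ → List ℕ → ℕ
occ13-2-at a []      = 0
occ13-2-at a (b ∷ t) = ∑ t (between a b)

occ13-2-∷ : ∀ a u → occ13-2 (a ∷ u) ≡ occ13-2-at a u + occ13-2 u
occ13-2-∷ a []      = refl
occ13-2-∷ a (b ∷ t) = cong (_+ occ13-2 (b ∷ t)) (countBetween≡∑ a b t)

module NewMaximum (n : ℕ) where

  private
    N = suc n
    _≤n : List ℕ → Set
    w ≤n = All (_≤ n) w

  between-N : ∀ a {b} → b ≤ N → between a b N ≡ 0
  between-N a b≤N rewrite <ᵇ-false b≤N | BoolP.∧-zeroʳ (a <ᵇ N) = refl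

  countBetween-from-N : ∀ c t → t ≤n → ∑ t (between N c) ≡ 0
  countBetween-from-N c []      _           = refl
  countBetween-from-N c (x ∷ t) (x≤n ∷ t≤n) rewrite <ᵇ-false {N} {x} (ℕP.m≤n⇒m≤1+n x≤n) = countBetween-from-N c t t≤n

  countBetween-to-N : ∀ a t → t ≤n → ∑ t (between a N) ≡ countAbove a t
  countBetween-to-N a []      _           = refl
  countBetween-to-N a (x ∷ t) (x≤n ∷ t≤n) rewrite <ᵇ-true {x} {N} (s≤s x≤n) | BoolP.∧-identityʳ (a <ᵇ x) =
    cong (above a x +_) (countBetween-to-N a t t≤n)

  above-N : ∀ {a} → a ≤ n → above a N ≡ 1
  above-N a≤n rewrite <ᵇ-true (s≤s a≤n) = refl

  countAbove-N : ∀ t → t ≤n → countAbove N t ≡ 0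
  countAbove-N []      _           = refl
  countAbove-N (x ∷ t) (x≤n ∷ t≤n) rewrite <ᵇ-false {N} {x} (ℕP.m≤n⇒m≤1+n x≤n) = countAbove-N t t≤n

  occ13-2-N∷ : ∀ t → t ≤n → occ13-2 (N ∷ t) ≡ occ13-2 t
  occ13-2-N∷ []      _          = refl
  occ13-2-N∷ (c ∷ t) (_ ∷ t≤n) = trans (occ13-2-∷ N (c ∷ t)) (cong (_+ occ13-2 (c ∷ t)) (countBetween-from-N c t t≤n))

  occ13-2-at-afterEach : ∀ a t → t ≤n → ∑ (afterEach N t) (occ13-2-at a) ≡ length t * occ13-2-at a t
  occ13-2-at-afterEach a []      _          = refl
  occ13-2-at-afterEach a (b ∷ t) (b≤n ∷ _) = begin
    ∑ (afterEach N (b ∷ t)) (occ13-2-at a)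
      ≡⟨ ∑-afterEach-∷ N b t (occ13-2-at a) ⟩
    between a b N + S + ∑ (afterEach N t) (λ u → ∑ u (between a b))
      ≡⟨ cong₂ (λ z s → z + S + s) 0≡ (∑-afterEach-∑ N t (between a b)) ⟩
    0 + S + length t * (between a b N + S)
      ≡⟨ cong (λ z → S + length t * (z + S)) 0≡ ⟩
    S + length t * (0 + S) ∎
    where
    open ≡-Reasoning
    S = ∑ t (between a b)
    0≡ : between a b N ≡ 0
    0≡ = between-N a (ℕP.m≤n⇒m≤1+n b≤n)

  occ13-2-afterEach : ∀ r → r ≤n → ∑ (afterEach N r) occ13-2 + occ13-2 r ≡ length r * occ13-2 r + nonInversions r
  occ13-2-afterEach []      _           = refl
  occ13-2-afterEach (a ∷ t) (a≤n ∷ t≤n) = begin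
    ∑ (afterEach N (a ∷ t)) occ13-2 + occ13-2 (a ∷ t)
      ≡⟨ cong (_+ occ13-2 (a ∷ t)) (∑-afterEach-∷ N a t occ13-2) ⟩
    occ13-2 (a ∷ N ∷ t) + ∑ (afterEach N t) (λ u → occ13-2 (a ∷ u)) + occ13-2 (a ∷ t)
      ≡⟨ cong₂ (λ x y → x + y + occ13-2 (a ∷ t)) first rest ⟩
    c + o + (l * d + Σ) + occ13-2 (a ∷ t)
      ≡⟨ cong (c + o + (l * d + Σ) +_) (occ13-2-∷ a t) ⟩
    c + o + (l * d + Σ) + (d + o)
      ≡⟨ regroup₁ c o l d Σ ⟩
    c + (Σ + o) + suc l * d + o
      ≡⟨ cong (λ z → c + z + suc l * d + o) (occ13-2-afterEach t t≤n) ⟩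
    c + (l * o + nonInversions t) + suc l * d + o
      ≡⟨ regroup₂ c o l d (nonInversions t) ⟩
    suc l * (d + o) + (c + nonInversions t)
      ≡⟨ cong (λ z → suc l * z + (c + nonInversions t)) (occ13-2-∷ a t) ⟨
    suc l * occ13-2 (a ∷ t) + nonInversions (a ∷ t) ∎
    where
    open ≡-Reasoning
    c = countAbove a t
    o = occ13-2 t
    l = length t
    d = occ13-2-at a t
    Σ = ∑ (afterEach N t) occ13-2
    first : occ13-2 (a ∷ N ∷ t) ≡ c + o
    first = trans (occ13-2-∷ a (N ∷ t)) (cong₂ _+_ (countBetween-to-N a t t≤n) (occ13-2-N∷ t t≤n))
    rest : ∑ (afterEach N t) (λ u → occ13-2 (a ∷ u)) ≡ l * d + Σ
    rest = trans (∑-cong (afterEach N t) (λ u _ → occ13-2-∷ a u))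
                 (trans (∑-+ (afterEach N t) (occ13-2-at a) occ13-2) (cong (_+ Σ) (occ13-2-at-afterEach a t t≤n)))
    regroup₁ : ∀ c o l d Σ → c + o + (l * d + Σ) + (d + o) ≡ c + (Σ + o) + suc l * d + o
    regroup₁ = solve-∀
    regroup₂ : ∀ c o l d v → c + (l * o + v) + suc l * d + o ≡ suc l * (d + o) + (c + v)
    regroup₂ = solve-∀

  countAbove-afterEach : ∀ {a} t → a ≤ n → ∑ (afterEach N t) (countAbove a) ≡ length t * suc (countAbove a t)
  countAbove-afterEach {a} t a≤n =
    trans (∑-afterEach-∑ N t (above a)) (cong (λ z → length t * (z + countAbove a t)) (above-N a≤n))

  nonInversions-afterEach : ∀ r → r ≤n →
                            ∑ (afterEach N r) nonInversions ≡ length r * nonInversions r + triangular (length r)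
  nonInversions-afterEach []      _           = refl
  nonInversions-afterEach (a ∷ t) (a≤n ∷ t≤n) = begin
    ∑ (afterEach N (a ∷ t)) nonInversions
      ≡⟨ ∑-afterEach-∷ N a t nonInversions ⟩
    nonInversions (a ∷ N ∷ t) + ∑ (afterEach N t) (λ u → nonInversions (a ∷ u))
      ≡⟨ cong₂ _+_ first rest ⟩
    suc c + v + (l * suc c + (l * v + triangular l))
      ≡⟨ regroup c v l (triangular l) ⟩
    suc l * (c + v) + triangular (suc l) ∎
    where
    open ≡-Reasoning
    c = countAbove a t
    v = nonInversions t
    l = length t
    first : nonInversions (a ∷ N ∷ t) ≡ suc c + v
    first = cong₂ (λ x y → x + c + (y + v)) (above-N a≤n) (countAbove-N t t≤n)
    rest : ∑ (afterEach N t) (λ u → nonInversions (a ∷ u)) ≡ l * suc c + (l * v + triangular l)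
    rest = trans (∑-+ (afterEach N t) (countAbove a) nonInversions)
                 (cong₂ _+_ (countAbove-afterEach t a≤n) (nonInversions-afterEach t t≤n))
    regroup : ∀ c v l T → suc c + v + (l * suc c + (l * v + T)) ≡ suc l * (c + v) + (suc l + T)
    regroup = solve-∀

  occ13-2-∷ʳ-N : ∀ w → w ≤n → occ13-2 (w ∷ʳ N) ≡ occ13-2 w
  occ13-2-∷ʳ-N []      _           = refl
  occ13-2-∷ʳ-N (a ∷ t) (_ ∷ t≤n) = begin
    occ13-2 (a ∷ (t ∷ʳ N))
      ≡⟨ occ13-2-∷ a (t ∷ʳ N) ⟩
    occ13-2-at a (t ∷ʳ N) + occ13-2 (t ∷ʳ N)
      ≡⟨ cong₂ _+_ (at-∷ʳ t t≤n) (occ13-2-∷ʳ-N t t≤n) ⟩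
    occ13-2-at a t + occ13-2 t
      ≡⟨ occ13-2-∷ a t ⟨
    occ13-2 (a ∷ t) ∎
    where
    open ≡-Reasoning
    at-∷ʳ : ∀ t → t ≤n → occ13-2-at a (t ∷ʳ N) ≡ occ13-2-at a t
    at-∷ʳ []      _         = refl
    at-∷ʳ (b ∷ t) (b≤n ∷ _) =
      trans (∑-++ t [ N ] (between a b))
            (trans (cong (λ z → ∑ t (between a b) + (z + 0)) (between-N a (ℕP.m≤n⇒m≤1+n b≤n))) (ℕP.+-identityʳ _))

  nonInversions-∷ʳ-N : ∀ w → w ≤n → nonInversions (w ∷ʳ N) ≡ nonInversions w + length w
  nonInversions-∷ʳ-N []      _           = refl
  nonInversions-∷ʳ-N (a ∷ t) (a≤n ∷ t≤n) = begin
    countAbove a (t ∷ʳ N) + nonInversions (t ∷ʳ N)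
      ≡⟨ cong₂ _+_ (∑-++ t [ N ] (above a)) (nonInversions-∷ʳ-N t t≤n) ⟩
    countAbove a t + (above a N + 0) + (nonInversions t + length t)
      ≡⟨ cong (λ z → countAbove a t + (z + 0) + (nonInversions t + length t)) (above-N a≤n) ⟩
    countAbove a t + 1 + (nonInversions t + length t)
      ≡⟨ regroup (countAbove a t) (nonInversions t) (length t) ⟩
    countAbove a t + nonInversions t + suc (length t) ∎
    where
    open ≡-Reasoning
    regroup : ∀ c v l → c + 1 + (v + l) ≡ c + v + suc l
    regroup = solve-∀

  ∑-insertAfter-oneTo : ∀ {w} → w ↭ oneTo n → ∀ h →
                        ∑ (upTo n) (λ k → h (insertAfter (suc k) N w)) ≡ ∑ (afterEach N w) h
  ∑-insertAfter-oneTo {w} w↭ h = begin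
    ∑ (upTo n) (λ k → h (insertAfter (suc k) N w))
      ≡⟨ ∑-map suc (upTo n) (λ i → h (insertAfter i N w)) ⟨
    ∑ (oneTo n) (λ i → h (insertAfter i N w))
      ≡⟨ ∑-↭ (λ i → h (insertAfter i N w)) w↭ ⟨
    ∑ w (λ i → h (insertAfter i N w))
      ≡⟨ ∑-map (λ i → insertAfter i N w) w h ⟨
    ∑ (map (λ i → insertAfter i N w) w) h
      ≡⟨ cong (λ ws → ∑ ws h) (map-insertAfter≡afterEach N w (Unique-resp-↭ (↭-sym w↭) (oneTo-unique n))) ⟩
    ∑ (afterEach N w) h ∎
    where open ≡-Reasoning

  module _ {w} (w↭ : w ↭ oneTo n) where

    private
      w≤n : w ≤n
      w≤n = All.tabulate (λ x∈ → proj₂ (∈-oneTo⁻ (↭P.∈-resp-↭ w↭ x∈)))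
      length-w : length w ≡ n
      length-w = trans (↭P.↭-length w↭) (length-oneTo n)

    occ13-2-children : ∑ (upTo n) (λ k → occ13-2 (insertAfter (suc k) N w)) + occ13-2 (w ∷ʳ N) ≡
                       n * occ13-2 w + nonInversions w
    occ13-2-children = begin
      ∑ (upTo n) (λ k → occ13-2 (insertAfter (suc k) N w)) + occ13-2 (w ∷ʳ N)
        ≡⟨ cong₂ _+_ (∑-insertAfter-oneTo w↭ occ13-2) (occ13-2-∷ʳ-N w w≤n) ⟩
      ∑ (afterEach N w) occ13-2 + occ13-2 w
        ≡⟨ occ13-2-afterEach w w≤n ⟩
      length w * occ13-2 w + nonInversions w
        ≡⟨ cong (λ l → l * occ13-2 w + nonInversions w) length-w ⟩
      n * occ13-2 w + nonInversions w ∎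
      where open ≡-Reasoning

    nonInversions-children : ∑ (upTo n) (λ k → nonInversions (insertAfter (suc k) N w)) + nonInversions (w ∷ʳ N) ≡
                             N * nonInversions w + (triangular n + n)
    nonInversions-children = begin
      ∑ (upTo n) (λ k → nonInversions (insertAfter (suc k) N w)) + nonInversions (w ∷ʳ N)
        ≡⟨ cong₂ _+_ (∑-insertAfter-oneTo w↭ nonInversions) (nonInversions-∷ʳ-N w w≤n) ⟩
      ∑ (afterEach N w) nonInversions + (nonInversions w + length w)
        ≡⟨ cong (_+ (nonInversions w + length w)) (nonInversions-afterEach w w≤n) ⟩
      length w * nonInversions w + triangular (length w) + (nonInversions w + length w)
        ≡⟨ cong (λ l → l * nonInversions w + triangular l + (nonInversions w + l)) length-w ⟩
      n * nonInversions w + triangular n + (nonInversions w + n)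
        ≡⟨ regroup (nonInversions w) (triangular n) n ⟩
      N * nonInversions w + (triangular n + n) ∎
      where
      open ≡-Reasoning
      regroup : ∀ v t n → n * v + t + (v + n) ≡ suc n * v + (t + n)
      regroup = solve-∀

-- Recurrences and their solution

open NewMaximum using (occ13-2-children; nonInversions-children)

∑-perms-suc-Flatten : ∀ n (f : List ℕ → ℕ) → ∑ (perms (suc n)) (λ σ → f (Flatten (suc n) σ)) ≡
  ∑ (perms n) (λ σ → ∑ (upTo n) (λ k → f (insertAfter (suc k) (suc n) (Flatten n σ))) + f (Flatten n σ ∷ʳ suc n))
∑-perms-suc-Flatten n f = trans (∑-perms-suc n (f ∘ Flatten (suc n))) (∑-cong (perms n) λ σ σ∈ →
  cong₂ _+_ (∑-cong (upTo n) (λ k k∈ → cong f (Flatten-cycleInsert-perms n (∈P.∈-upTo⁻ k∈) σ∈)))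
            (cong f (Flatten-append-perms n σ∈)))

∑-perms-const : ∀ n c → ∑ (perms n) (λ _ → c) ≡ n ! * c
∑-perms-const zero    c = refl
∑-perms-const (suc n) c = begin
  ∑ (perms (suc n)) (λ _ → c)
    ≡⟨ ∑-perms-suc n (λ _ → c) ⟩
  ∑ (perms n) (λ _ → ∑ (upTo n) (λ _ → c) + c)
    ≡⟨ cong (λ m → ∑ (perms n) (λ _ → m + c)) (trans (∑-const (upTo n) c) (cong (_* c) (LP.length-upTo n))) ⟩
  ∑ (perms n) (λ _ → n * c + c)
    ≡⟨ ∑-perms-const n (n * c + c) ⟩
  n ! * (n * c + c)
    ≡⟨ regroup (n !) n c ⟩
  suc n ! * c ∎
  where
  open ≡-Reasoning
  regroup : ∀ f n c → f * (n * c + c) ≡ (f + n * f) * c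
  regroup = solve-∀

total13-2≡∑ : ∀ n → total13-2 n ≡ ∑ (perms n) (λ σ → occ13-2 (Flatten n σ))
total13-2≡∑ n = sym (LP.foldr-map _+_ (λ σ → occ13-2 (Flatten n σ)) 0 (perms n))

totalNonInversions : ℕ → ℕ
totalNonInversions n = ∑ (perms n) (λ σ → nonInversions (Flatten n σ))

total13-2-suc : ∀ n → total13-2 (suc n) ≡ n * total13-2 n + totalNonInversions n
total13-2-suc n = begin
  total13-2 (suc n)
    ≡⟨ total13-2≡∑ (suc n) ⟩
  ∑ (perms (suc n)) (λ σ → occ13-2 (Flatten (suc n) σ))
    ≡⟨ ∑-perms-suc-Flatten n occ13-2 ⟩
  ∑ (perms n) (λ σ → ∑ (upTo n) (λ k → occ13-2 (insertAfter (suc k) (suc n) (Flatten n σ))) + occ13-2 (Flatten n σ ∷ʳ suc n))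
    ≡⟨ ∑-cong (perms n) (λ σ σ∈ → occ13-2-children n (Flatten-↭-oneTo n σ∈)) ⟩
  ∑ (perms n) (λ σ → n * occ13-2 (Flatten n σ) + nonInversions (Flatten n σ))
    ≡⟨ ∑-+ (perms n) _ _ ⟩
  ∑ (perms n) (λ σ → n * occ13-2 (Flatten n σ)) + totalNonInversions n
    ≡⟨ cong (_+ totalNonInversions n) (∑-*ˡ (perms n) n _) ⟩
  n * ∑ (perms n) (λ σ → occ13-2 (Flatten n σ)) + totalNonInversions n
    ≡⟨ cong (λ t → n * t + totalNonInversions n) (total13-2≡∑ n) ⟨
  n * total13-2 n + totalNonInversions n ∎
  where open ≡-Reasoning

totalNonInversions-suc : ∀ n →
                         totalNonInversions (suc n) ≡ suc n * totalNonInversions n + n ! * (triangular n + n)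
totalNonInversions-suc n = begin
  totalNonInversions (suc n)
    ≡⟨ ∑-perms-suc-Flatten n nonInversions ⟩
  ∑ (perms n) (λ σ → ∑ (upTo n) (λ k → nonInversions (insertAfter (suc k) (suc n) (Flatten n σ))) + nonInversions (Flatten n σ ∷ʳ suc n))
    ≡⟨ ∑-cong (perms n) (λ σ σ∈ → nonInversions-children n (Flatten-↭-oneTo n σ∈)) ⟩
  ∑ (perms n) (λ σ → suc n * nonInversions (Flatten n σ) + (triangular n + n))
    ≡⟨ ∑-+ (perms n) _ _ ⟩
  ∑ (perms n) (λ σ → suc n * nonInversions (Flatten n σ)) + ∑ (perms n) (λ _ → triangular n + n)
    ≡⟨ cong₂ _+_ (∑-*ˡ (perms n) (suc n) _) (∑-perms-const n (triangular n + n)) ⟩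
  suc n * totalNonInversions n + n ! * (triangular n + n) ∎
  where open ≡-Reasoning

-- n! · H_n
harmonicNumerator : ℕ → ℕ
harmonicNumerator zero    = 0
harmonicNumerator (suc n) = suc n * harmonicNumerator n + n !

2*triangular : ∀ n → 2 * triangular n ≡ n * suc n
2*triangular zero    = refl
2*triangular (suc n) = trans (ℕP.*-distribˡ-+ 2 (suc n) (triangular n))
                             (trans (cong (2 * suc n +_) (2*triangular n)) (regroup n))
  where
  regroup : ∀ n → 2 * suc n + n * suc n ≡ suc n * suc (suc n)
  regroup = solve-∀

totalNonInversions-closed : ∀ n → 4 * totalNonInversions n + 4 * harmonicNumerator n ≡ n ! * (n * n + 3 * n)
totalNonInversions-closed zero    = refl
totalNonInversions-closed (suc n) = begin
  4 * U (suc n) + 4 * D (suc n)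
    ≡⟨ cong (λ u → 4 * u + 4 * D (suc n)) (totalNonInversions-suc n) ⟩
  4 * (suc n * U n + n ! * (triangular n + n)) + 4 * (suc n * D n + n !)
    ≡⟨ regroup₁ (U n) (D n) (triangular n) n (n !) ⟩
  suc n * (4 * U n + 4 * D n) + n ! * (2 * (2 * triangular n)) + n ! * (4 * n + 4)
    ≡⟨ cong₂ (λ x y → suc n * x + n ! * (2 * y) + n ! * (4 * n + 4)) (totalNonInversions-closed n) (2*triangular n) ⟩
  suc n * (n ! * (n * n + 3 * n)) + n ! * (2 * (n * suc n)) + n ! * (4 * n + 4)
    ≡⟨ regroup₂ n (n !) ⟩
  suc n ! * (suc n * suc n + 3 * suc n) ∎
  where
  open ≡-Reasoning
  U = totalNonInversions
  D = harmonicNumerator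
  regroup₁ : ∀ u d t n f → 4 * (suc n * u + f * (t + n)) + 4 * (suc n * d + f) ≡
                           suc n * (4 * u + 4 * d) + f * (2 * (2 * t)) + f * (4 * n + 4)
  regroup₁ = solve-∀
  regroup₂ : ∀ n f → suc n * (f * (n * n + 3 * n)) + f * (2 * (n * suc n)) + f * (4 * n + 4) ≡
                     (f + n * f) * (suc n * suc n + 3 * suc n)
  regroup₂ = solve-∀

total13-2-closed : ∀ n → 1 ≤ n → 12 * total13-2 n + 12 * harmonicNumerator n ≡ n ! * (n * n + 3 * n + 8)
total13-2-closed (suc zero)    _ = refl
total13-2-closed (suc n@(suc _)) _ = begin
  12 * Tot (suc n) + 12 * D (suc n)
    ≡⟨ cong (λ t → 12 * t + 12 * D (suc n)) (total13-2-suc n) ⟩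
  12 * (n * Tot n + U n) + 12 * (suc n * D n + n !)
    ≡⟨ regroup₁ (Tot n) (U n) (D n) n (n !) ⟩
  n * (12 * Tot n + 12 * D n) + 3 * (4 * U n + 4 * D n) + 12 * n !
    ≡⟨ cong₂ (λ x y → n * x + 3 * y + 12 * n !) (total13-2-closed n (s≤s z≤n)) (totalNonInversions-closed n) ⟩
  n * (n ! * (n * n + 3 * n + 8)) + 3 * (n ! * (n * n + 3 * n)) + 12 * n !
    ≡⟨ regroup₂ n (n !) ⟩
  suc n ! * (suc n * suc n + 3 * suc n + 8) ∎
  where
  open ≡-Reasoning
  Tot = total13-2
  U = totalNonInversions
  D = harmonicNumerator
  regroup₁ : ∀ t u d n f → 12 * (n * t + u) + 12 * (suc n * d + f) ≡
                           n * (12 * t + 12 * d) + 3 * (4 * u + 4 * d) + 12 * f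
  regroup₁ = solve-∀
  regroup₂ : ∀ n f → n * (f * (n * n + 3 * n + 8)) + 3 * (f * (n * n + 3 * n)) + 12 * f ≡
                     (f + n * f) * (suc n * suc n + 3 * suc n + 8)
  regroup₂ = solve-∀

open import Data.Integer as ℤ using (+_)
import Data.Integer.Properties as ℤP
open import Data.Rational as ℚ using (0ℚ; _/_; _-_; toℚᵘ)
import Data.Rational.Properties as ℚP
open import Data.Rational.Unnormalised as ℚᵘ using (mkℚᵘ; *≡*) renaming (_≃_ to _≃ᵘ_)
import Data.Rational.Unnormalised.Properties as ℚᵘP

ℚᵘ-/-≃ : ∀ p q d e .{{_ : ℕ.NonZero d}} .{{_ : ℕ.NonZero e}} → p * e ≡ q * d → + p ℚᵘ./ d ≃ᵘ + q ℚᵘ./ e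
ℚᵘ-/-≃ p q (suc d) (suc e) eq = *≡* (trans (sym (ℤP.pos-* p (suc e))) (trans (cong +_ eq) (ℤP.pos-* q (suc d))))

ℚᵘ-/-+ : ∀ p q d e .{{_ : ℕ.NonZero d}} .{{_ : ℕ.NonZero e}} →
         (+ p ℚᵘ./ d) ℚᵘ.+ (+ q ℚᵘ./ e) ≡ (+ (p * e + q * d) ℚᵘ./ (d * e)) {{ℕP.m*n≢0 d e}}
ℚᵘ-/-+ p q (suc d) (suc e) =
  cong (λ z → mkℚᵘ z _)
       (sym (trans (ℤP.pos-+ (p * suc e) (q * suc d)) (cong₂ ℤ._+_ (ℤP.pos-* p (suc e)) (ℤP.pos-* q (suc d)))))

toℚᵘ-/ : ∀ p d .{{_ : ℕ.NonZero d}} → toℚᵘ (p / d) ≃ᵘ p ℚᵘ./ d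
toℚᵘ-/ p (suc d) = ℚP.toℚᵘ-fromℚᵘ (mkℚᵘ p d)

harmonic-toℚᵘ : ∀ n → toℚᵘ (harmonic n) ≃ᵘ (+ harmonicNumerator n ℚᵘ./ n !) {{n !≢0}}
harmonic-toℚᵘ zero    = *≡* refl
harmonic-toℚᵘ (suc n) = begin
  toℚᵘ (harmonic n ℚ.+ + 1 / suc n)
    ≈⟨ ℚP.toℚᵘ-homo-+ (harmonic n) (+ 1 / suc n) ⟩
  toℚᵘ (harmonic n) ℚᵘ.+ toℚᵘ (+ 1 / suc n)
    ≈⟨ ℚᵘP.+-cong (harmonic-toℚᵘ n) (toℚᵘ-/ (+ 1) (suc n)) ⟩
  (+ D ℚᵘ./ n !) {{n !≢0}} ℚᵘ.+ (+ 1 ℚᵘ./ suc n)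
    ≡⟨ ℚᵘ-/-+ D 1 (n !) (suc n) {{n !≢0}} ⟩
  (+ (D * suc n + 1 * n !) ℚᵘ./ (n ! * suc n)) {{ℕP.m*n≢0 (n !) (suc n) {{n !≢0}}}}
    ≈⟨ ℚᵘ-/-≃ _ _ (n ! * suc n) (suc n !) {{ℕP.m*n≢0 (n !) (suc n) {{n !≢0}}}} {{suc n !≢0}} (regroup D n (n !)) ⟩
  (+ harmonicNumerator (suc n) ℚᵘ./ suc n !) {{suc n !≢0}} ∎
  where
  open ℚᵘP.≃-Reasoning
  D = harmonicNumerator n
  regroup : ∀ D n f → (D * suc n + 1 * f) * (f + n * f) ≡ (suc n * D + f) * (f * suc n)
  regroup = solve-∀

average+harmonic : ∀ n → 1 ≤ n → average13-2 n ℚ.+ harmonic n ≡ + (n * n + 3 * n + 8) / 12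
average+harmonic n 1≤n = ℚP.toℚᵘ-injective (begin
  toℚᵘ (average13-2 n ℚ.+ harmonic n)
    ≈⟨ ℚP.toℚᵘ-homo-+ (average13-2 n) (harmonic n) ⟩
  toℚᵘ (average13-2 n) ℚᵘ.+ toℚᵘ (harmonic n)
    ≈⟨ ℚᵘP.+-cong (toℚᵘ-/ (+ total) (n !) {{n !≢0}}) (harmonic-toℚᵘ n) ⟩
  (+ total ℚᵘ./ n !) {{n !≢0}} ℚᵘ.+ (+ D ℚᵘ./ n !) {{n !≢0}}
    ≡⟨ ℚᵘ-/-+ total D (n !) (n !) {{n !≢0}} {{n !≢0}} ⟩
  (+ (total * n ! + D * n !) ℚᵘ./ (n ! * n !)) {{ℕP.m*n≢0 (n !) (n !) {{n !≢0}} {{n !≢0}}}}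
    ≈⟨ ℚᵘ-/-≃ _ _ (n ! * n !) 12 {{ℕP.m*n≢0 (n !) (n !) {{n !≢0}} {{n !≢0}}}} cleared ⟩
  + a ℚᵘ./ 12
    ≈⟨ toℚᵘ-/ (+ a) 12 ⟨
  toℚᵘ (+ a / 12) ∎)
  where
  open ℚᵘP.≃-Reasoning
  total = total13-2 n
  D = harmonicNumerator n
  a = n * n + 3 * n + 8
  cleared : (total * n ! + D * n !) * 12 ≡ a * (n ! * n !)
  cleared = trans (reorder total D (n !)) (trans (cong (_* n !) (total13-2-closed n 1≤n)) (reorder′ (n !) a))
    where
    reorder : ∀ t d f → (t * f + d * f) * 12 ≡ (12 * t + 12 * d) * f
    reorder = solve-∀
    reorder′ : ∀ f a → f * a * f ≡ a * (f * f)
    reorder′ = solve-∀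

corollary2p3 : (n : ℕ) → n ≥ 1 →
    average13-2 n ≡ (+ (n * n + 3 * n + 8) / 12) - harmonic n
corollary2p3 n 1≤n = begin
  average13-2 n
    ≡⟨ ℚP.+-identityʳ (average13-2 n) ⟨
  average13-2 n ℚ.+ 0ℚ
    ≡⟨ cong (average13-2 n ℚ.+_) (ℚP.+-inverseʳ (harmonic n)) ⟨
  average13-2 n ℚ.+ (harmonic n - harmonic n)
    ≡⟨ ℚP.+-assoc (average13-2 n) (harmonic n) (ℚ.- harmonic n) ⟨
  (average13-2 n ℚ.+ harmonic n) - harmonic n
    ≡⟨ cong (_- harmonic n) (average+harmonic n 1≤n) ⟩
  (+ (n * n + 3 * n + 8) / 12) - harmonic n ∎
  where open ≡-Reasoning
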